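{- Let $n\ge1$ and let $\mathrm{CMP}(n)$ be the set of binary words $\mathbf b=(b_1,\dots,b_{2n})$ which arise from pairs $(x_0,\mathbf b)$ with $x_0\in\{1,\dots,n\}$, $\mathbf b$ having $n$ zeros and $n$ ones, $b_{2n}=1$, $b_i=1-b_{n+i}$ for all $i\in\{1,\dots,n\}$, and such that the lattice path from $(x_0,0)$ taking an east step $(1,0)$ for each $0$ and a north step $(0,1)$ for each $1$ never visits a lattice point on the lines $y=x$ or $y=x-(n+2)$. Then \[ \sum_{\mathbf b\in\mathrm{CMP}(n)}q^{\mathrm{maj}(\mathbf b)}\equiv\frac12\sum_{k=0}^n q^{\binom{k}{2}}\genfrac{[}{]}{0pt}{}{n}{k}_q \pmod{q^n-1}. \]
   Context: $\mathrm{maj}(\mathbf b)=\sum\{i: b_i>b_{i+1}\}$. For each such word the starting point $x_0$ is uniquely determined, so $\mathrm{CMP}(n)$ (the circular Möbius paths) may be identified with its set of words. $\genfrac{[}{]}{0pt}{}{n}{k}_q$ is the Gaussian binomial coefficient; the right-hand polynomial has integer coefficients. -}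

module Defs where

open import Data.Bool using (Bool; true; false; not)
open import Data.Nat as ℕ using (ℕ; zero; suc; _≤_)
open import Data.Nat.Combinatorics using (_C_)
open import Data.Integer as ℤ using (ℤ; +_)
open import Data.List using (List; []; _∷_; replicate; _++_; map; foldr; take; drop; last; upTo)
open import Data.Maybe using (Maybe; just)
open import Data.Product using (Σ; _×_; ∃-syntax)
open import Relation.Binary.PropositionalEquality using (_≡_; _≢_)

-- Univariate polynomials over ℤ as coefficient lists (constant term first).

Poly : Set
Poly = List ℤ

coeff : Poly → ℕ → ℤ
coeff []       _       = + 0
coeff (a ∷ _)  zero    = a
coeff (_ ∷ as) (suc i) = coeff as i

infixl 6 _+ₚ_ _-ₚ_
infixl 7 _*ₚ_ _·ₚ_

_+ₚ_ : Poly → Poly → Poly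
[]       +ₚ bs       = bs
(a ∷ as) +ₚ []       = a ∷ as
(a ∷ as) +ₚ (b ∷ bs) = (a ℤ.+ b) ∷ (as +ₚ bs)

_·ₚ_ : ℤ → Poly → Poly
c ·ₚ as = map (c ℤ.*_) as

_-ₚ_ : Poly → Poly → Poly
as -ₚ bs = as +ₚ (ℤ.- (+ 1)) ·ₚ bs

_*ₚ_ : Poly → Poly → Poly
[]       *ₚ bs = []
(a ∷ as) *ₚ bs = a ·ₚ bs +ₚ (+ 0 ∷ (as *ₚ bs))

oneₚ : Poly
oneₚ = + 1 ∷ []

qpow : ℕ → Poly
qpow k = replicate k (+ 0) ++ (+ 1 ∷ [])

sumₚ : List Poly → Poly
sumₚ = foldr _+ₚ_ []

_≈ₚ_ : Poly → Poly → Set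
A ≈ₚ B = ∀ i → coeff A i ≡ coeff B i

_≡_mod_ : Poly → Poly → Poly → Set
A ≡ B mod M = ∃[ H ] ((A -ₚ B) ≈ₚ (M *ₚ H))

gauss : ℕ → ℕ → Poly
gauss n       zero    = oneₚ
gauss zero    (suc k) = []
gauss (suc n) (suc k) = gauss n k +ₚ qpow (suc k) *ₚ gauss n (suc k)

-- Binary words (false = 0, true = 1).

numOnes : List Bool → ℕ
numOnes []           = 0
numOnes (true  ∷ bs) = suc (numOnes bs)
numOnes (false ∷ bs) = numOnes bs

numZeros : List Bool → ℕ
numZeros []           = 0
numZeros (true  ∷ bs) = numZeros bs
numZeros (false ∷ bs) = suc (numZeros bs)

-- maj, with positions numbered from i: sum of positions j with b_j > b_{j+1}
majFrom : ℕ → List Bool → ℕ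
majFrom i (true ∷ false ∷ bs) = i ℕ.+ majFrom (suc i) (false ∷ bs)
majFrom i (_ ∷ b ∷ bs)        = majFrom (suc i) (b ∷ bs)
majFrom i _                   = 0

maj : List Bool → ℕ
maj = majFrom 1

OffLines : ℕ → ℕ → ℕ → Set
OffLines n x y = (y ≢ x) × (y ℕ.+ (n ℕ.+ 2) ≢ x)

Avoids : ℕ → ℕ → ℕ → List Bool → Set
Avoids n x y []           = OffLines n x y
Avoids n x y (false ∷ bs) = OffLines n x y × Avoids n (suc x) y bs
Avoids n x y (true  ∷ bs) = OffLines n x y × Avoids n x (suc y) bs

IsCMP : ℕ → List Bool → Set
IsCMP n b =
  Σ ℕ λ x₀ →
    (1 ≤ x₀) × (x₀ ≤ n)
  × (numZeros b ≡ n) × (numOnes b ≡ n)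
  × (last b ≡ just true)
  × (take n b ≡ map not (drop n b))
  × Avoids n x₀ 0 b

module Submission where

open import Defs

-- Plan.  Both sides are identified with explicit multisets of exponents.
--
-- A polynomial ∑_{e∈L} q^e is handled through its exponent list L, so that
--   permuting L does not change it (ExponentMultisets).
-- * The q-binomial theorem  ∏_{i<n} (1 + q^(a+i)) = ∑_k q^(ak + C(k,2)) [n,k]
--   holds as a permutation of exponent lists (QBinomialTheorem).
-- * For a word v ending in 1, of length n, with complement v̄:
--   maj(v̄ v) = chg(v) + n · des(v), chg being the sum of the positions where
--   v changes letter; over all such v, chg runs once through the subset sums
--   of {1, …, n-1} (WordStatistics).
-- * CMP(n) is exactly the set of words v̄ v with v as above: the conditions
--   on the letters force this shape, and a starting point x₀ with an
--   admissible path always exists (LatticePaths, CircularMobiusWords).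
-- Hence ∑ q^maj ≡ ∏_{i=1}^{n-1} (1 + q^i) mod q^n - 1, and doubling it gives
-- the factor 1 + q^0 of the q-binomial theorem at a = 0.

module Polynomials where

  open import Data.Nat using (zero; suc)
  import Data.Nat as ℕ
  import Data.Nat.Properties as ℕP
  open import Data.Integer using (+_; +0; _+_; _*_)
  import Data.Integer.Properties as ℤP
  open import Data.Integer.Tactic.RingSolver using (solve-∀)
  open import Data.List using ([]; _∷_)
  open import Level using (0ℓ)
  open import Relation.Binary.Bundles using (Setoid)
  open import Relation.Binary.PropositionalEquality

  -- Coefficientwise equality, wrapped in a record so that both
  -- polynomials can be inferred from a proof.
  infix 4 _≃_
  record _≃_ (P Q : Poly) : Set where
    constructor coeffwise
    field at : ∀ i → coeff P i ≡ coeff Q i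
  open _≃_ public

  ≃-setoid : Setoid 0ℓ 0ℓ
  ≃-setoid = record
    { Carrier = Poly ; _≈_ = _≃_
    ; isEquivalence = record
      { refl  = coeffwise λ _ → refl
      ; sym   = λ p → coeffwise λ i → sym (at p i)
      ; trans = λ p q → coeffwise λ i → trans (at p i) (at q i) } }

  open Setoid ≃-setoid public using () renaming (refl to ≃-refl; sym to ≃-sym; trans to ≃-trans)

  ≡⇒≃ : ∀ {P Q} → P ≡ Q → P ≃ Q
  ≡⇒≃ refl = ≃-refl

  private variable
    P Q R T : Poly

  coeff-+ : ∀ P Q i → coeff (P +ₚ Q) i ≡ coeff P i + coeff Q i
  coeff-+ []       Q        i       = sym (ℤP.+-identityˡ _)
  coeff-+ (a ∷ P)  []       i       = sym (ℤP.+-identityʳ _)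
  coeff-+ (a ∷ P)  (b ∷ Q)  zero    = refl
  coeff-+ (a ∷ P)  (b ∷ Q)  (suc i) = coeff-+ P Q i

  coeff-· : ∀ c P i → coeff (c ·ₚ P) i ≡ c * coeff P i
  coeff-· c []      i       = sym (ℤP.*-zeroʳ c)
  coeff-· c (a ∷ P) zero    = refl
  coeff-· c (a ∷ P) (suc i) = coeff-· c P i

  coeff-*∷ : ∀ a P Q i → coeff ((a ∷ P) *ₚ Q) i ≡ a * coeff Q i + coeff (+0 ∷ (P *ₚ Q)) i
  coeff-*∷ a P Q i = trans (coeff-+ (a ·ₚ Q) _ i) (cong (_+ _) (coeff-· a Q i))

  coeff-shift-+ : ∀ P Q i → coeff (+0 ∷ (P +ₚ Q)) i ≡ coeff (+0 ∷ P) i + coeff (+0 ∷ Q) i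
  coeff-shift-+ P Q zero    = refl
  coeff-shift-+ P Q (suc i) = coeff-+ P Q i

  +-cong : P ≃ Q → R ≃ T → P +ₚ R ≃ Q +ₚ T
  +-cong {P} {Q} {R} {T} p r = coeffwise λ i → begin
    coeff (P +ₚ R) i       ≡⟨ coeff-+ P R i ⟩
    coeff P i + coeff R i  ≡⟨ cong₂ _+_ (at p i) (at r i) ⟩
    coeff Q i + coeff T i  ≡⟨ coeff-+ Q T i ⟨
    coeff (Q +ₚ T) i       ∎
    where open ≡-Reasoning

  shift-cong : P ≃ Q → +0 ∷ P ≃ +0 ∷ Q
  shift-cong p = coeffwise λ { zero → refl ; (suc i) → at p i }

  +-assoc : ∀ P Q R → (P +ₚ Q) +ₚ R ≃ P +ₚ (Q +ₚ R)
  +-assoc P Q R = coeffwise λ i → begin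
    coeff ((P +ₚ Q) +ₚ R) i                 ≡⟨ coeff-+ (P +ₚ Q) R i ⟩
    coeff (P +ₚ Q) i + coeff R i            ≡⟨ cong (_+ coeff R i) (coeff-+ P Q i) ⟩
    (coeff P i + coeff Q i) + coeff R i     ≡⟨ ℤP.+-assoc (coeff P i) _ _ ⟩
    coeff P i + (coeff Q i + coeff R i)     ≡⟨ cong (λ x → coeff P i + x) (coeff-+ Q R i) ⟨
    coeff P i + coeff (Q +ₚ R) i            ≡⟨ coeff-+ P (Q +ₚ R) i ⟨
    coeff (P +ₚ (Q +ₚ R)) i                 ∎
    where open ≡-Reasoning

  +-comm : ∀ P Q → P +ₚ Q ≃ Q +ₚ P
  +-comm P Q = coeffwise λ i → begin
    coeff (P +ₚ Q) i       ≡⟨ coeff-+ P Q i ⟩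
    coeff P i + coeff Q i  ≡⟨ ℤP.+-comm (coeff P i) _ ⟩
    coeff Q i + coeff P i  ≡⟨ coeff-+ Q P i ⟨
    coeff (Q +ₚ P) i       ∎
    where open ≡-Reasoning

  two-· : ∀ P → (+ 2) ·ₚ P ≃ P +ₚ P
  two-· P = coeffwise λ i → begin
    coeff ((+ 2) ·ₚ P) i   ≡⟨ coeff-· (+ 2) P i ⟩
    + 2 * coeff P i        ≡⟨ double (coeff P i) ⟩
    coeff P i + coeff P i  ≡⟨ coeff-+ P P i ⟨
    coeff (P +ₚ P) i       ∎
    where
    open ≡-Reasoning
    double : ∀ x → + 2 * x ≡ x + x
    double = solve-∀

  *-congʳ : ∀ M → P ≃ Q → M *ₚ P ≃ M *ₚ Q
  *-congʳ []      p = ≃-refl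
  *-congʳ {P} {Q} (a ∷ M) p = coeffwise λ i → begin
    coeff ((a ∷ M) *ₚ P) i                     ≡⟨ coeff-*∷ a M P i ⟩
    a * coeff P i + coeff (+0 ∷ (M *ₚ P)) i    ≡⟨ cong₂ _+_ (cong (a *_) (at p i)) (at (shift-cong (*-congʳ M p)) i) ⟩
    a * coeff Q i + coeff (+0 ∷ (M *ₚ Q)) i    ≡⟨ coeff-*∷ a M Q i ⟨
    coeff ((a ∷ M) *ₚ Q) i                     ∎
    where open ≡-Reasoning

  *-zeroʳ : ∀ M → M *ₚ [] ≃ []
  *-zeroʳ []      = ≃-refl
  *-zeroʳ (a ∷ M) = coeffwise λ { zero → refl ; (suc i) → at (*-zeroʳ M) i }

  *-distribˡ : ∀ M P Q → M *ₚ (P +ₚ Q) ≃ M *ₚ P +ₚ M *ₚ Q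
  *-distribˡ []      P Q = ≃-refl
  *-distribˡ (a ∷ M) P Q = coeffwise λ i → begin
    coeff ((a ∷ M) *ₚ (P +ₚ Q)) i
      ≡⟨ coeff-*∷ a M (P +ₚ Q) i ⟩
    a * coeff (P +ₚ Q) i + coeff (+0 ∷ (M *ₚ (P +ₚ Q))) i
      ≡⟨ cong₂ _+_ (cong (a *_) (coeff-+ P Q i))
                   (trans (at (shift-cong (*-distribˡ M P Q)) i) (coeff-shift-+ (M *ₚ P) (M *ₚ Q) i)) ⟩
    a * (coeff P i + coeff Q i) + (coeff (+0 ∷ (M *ₚ P)) i + coeff (+0 ∷ (M *ₚ Q)) i)
      ≡⟨ regroup a (coeff P i) (coeff Q i) _ _ ⟩
    (a * coeff P i + coeff (+0 ∷ (M *ₚ P)) i) + (a * coeff Q i + coeff (+0 ∷ (M *ₚ Q)) i)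
      ≡⟨ cong₂ _+_ (coeff-*∷ a M P i) (coeff-*∷ a M Q i) ⟨
    coeff ((a ∷ M) *ₚ P) i + coeff ((a ∷ M) *ₚ Q) i
      ≡⟨ coeff-+ ((a ∷ M) *ₚ P) _ i ⟨
    coeff ((a ∷ M) *ₚ P +ₚ (a ∷ M) *ₚ Q) i ∎
    where
    open ≡-Reasoning
    regroup : ∀ a p q p′ q′ → a * (p + q) + (p′ + q′) ≡ (a * p + p′) + (a * q + q′)
    regroup = solve-∀

  *-identityʳ : ∀ M → M *ₚ oneₚ ≃ M
  *-identityʳ []      = ≃-refl
  *-identityʳ (a ∷ M) = coeffwise λ
    { zero    → trans (ℤP.+-identityʳ _) (ℤP.*-identityʳ a)
    ; (suc i) → trans (coeff-*∷ a M oneₚ (suc i))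
                      (trans (cong₂ _+_ (ℤP.*-zeroʳ a) (at (*-identityʳ M) i)) (ℤP.+-identityˡ _)) }

  *-shiftʳ : ∀ M P → M *ₚ (+0 ∷ P) ≃ +0 ∷ (M *ₚ P)
  *-shiftʳ []      P = coeffwise λ { zero → refl ; (suc i) → refl }
  *-shiftʳ (a ∷ M) P = coeffwise λ
    { zero    → trans (ℤP.+-identityʳ _) (ℤP.*-zeroʳ a)
    ; (suc i) → trans (coeff-*∷ a M (+0 ∷ P) (suc i))
                      (trans (cong (λ x → a * coeff P i + x) (at (*-shiftʳ M P) i)) (sym (coeff-*∷ a M P i))) }

  qpow-+ : ∀ a b → qpow a *ₚ qpow b ≃ qpow (a ℕ.+ b)
  qpow-+ a zero    = ≃-trans (*-identityʳ (qpow a)) (≡⇒≃ (cong qpow (sym (ℕP.+-identityʳ a))))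
  qpow-+ a (suc b) = ≃-trans (*-shiftʳ (qpow a) (qpow b))
                    (≃-trans (shift-cong (qpow-+ a b)) (≡⇒≃ (cong qpow (sym (ℕP.+-suc a b)))))

module PolynomialCongruences where

  open Polynomials
  open import Data.Nat using (ℕ; zero; suc)
  import Data.Nat as ℕ
  import Data.Nat.Properties as ℕP
  open import Data.Integer using (+_; +0; _+_; -_; _-_)
  import Data.Integer.Properties as ℤP
  open import Data.Integer.Tactic.RingSolver using (solve-∀)
  open import Data.List using ([]; _∷_; map)
  open import Data.List.Membership.Propositional using (_∈_)
  open import Data.List.Relation.Unary.Any using (here; there)
  open import Relation.Binary.PropositionalEquality
  open import Data.Product using (_,_)
  open import Function using (_∘_)

  private variable
    P Q R T : Poly

  coeff-- : ∀ P Q i → coeff (P -ₚ Q) i ≡ coeff P i - coeff Q i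
  coeff-- P Q i = trans (coeff-+ P _ i) (cong (λ x → coeff P i + x) (trans (coeff-· (- (+ 1)) Q i) (ℤP.-1*i≡-i (coeff Q i))))

  module Congruence (M : Poly) where

    infix 4 _≡ₘ_
    record _≡ₘ_ (P Q : Poly) : Set where
      constructor _by_
      field
        quotient   : Poly
        difference : P -ₚ Q ≃ M *ₚ quotient

    toMod : P ≡ₘ Q → P ≡ Q mod M
    toMod (H by d) = H , at d

    private
      difference-at : (c : P ≡ₘ Q) → ∀ i → coeff P i - coeff Q i ≡ coeff (M *ₚ _≡ₘ_.quotient c) i
      difference-at {P} {Q} (H by d) i = trans (sym (coeff-- P Q i)) (at d i)

      multiples-add : ∀ H K i → coeff (M *ₚ H) i + coeff (M *ₚ K) i ≡ coeff (M *ₚ (H +ₚ K)) i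
      multiples-add H K i = trans (sym (coeff-+ (M *ₚ H) (M *ₚ K) i)) (sym (at (*-distribˡ M H K) i))

    ≃⇒≡ₘ : P ≃ Q → P ≡ₘ Q
    ≃⇒≡ₘ {P} {Q} p = [] by coeffwise λ i → begin
      coeff (P -ₚ Q) i        ≡⟨ coeff-- P Q i ⟩
      coeff P i - coeff Q i   ≡⟨ cong (_- coeff Q i) (at p i) ⟩
      coeff Q i - coeff Q i   ≡⟨ ℤP.+-inverseʳ (coeff Q i) ⟩
      +0                      ≡⟨ at (*-zeroʳ M) i ⟨
      coeff (M *ₚ []) i       ∎
      where open ≡-Reasoning

    ≡ₘ-trans : P ≡ₘ Q → Q ≡ₘ R → P ≡ₘ R
    ≡ₘ-trans {P} {Q} {R} c@(H by _) d@(K by _) = (H +ₚ K) by coeffwise λ i → begin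
      coeff (P -ₚ R) i                                     ≡⟨ coeff-- P R i ⟩
      coeff P i - coeff R i                                ≡⟨ telescope (coeff P i) (coeff Q i) (coeff R i) ⟩
      (coeff P i - coeff Q i) + (coeff Q i - coeff R i)    ≡⟨ cong₂ _+_ (difference-at c i) (difference-at d i) ⟩
      coeff (M *ₚ H) i + coeff (M *ₚ K) i                  ≡⟨ multiples-add H K i ⟩
      coeff (M *ₚ (H +ₚ K)) i                              ∎
      where
      open ≡-Reasoning
      telescope : ∀ p q r → p - r ≡ (p - q) + (q - r)
      telescope = solve-∀

    ≡ₘ-+ : P ≡ₘ Q → R ≡ₘ T → P +ₚ R ≡ₘ Q +ₚ T
    ≡ₘ-+ {P} {Q} {R} {T} c@(H by _) d@(K by _) = (H +ₚ K) by coeffwise λ i → begin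
      coeff ((P +ₚ R) -ₚ (Q +ₚ T)) i
        ≡⟨ coeff-- (P +ₚ R) (Q +ₚ T) i ⟩
      coeff (P +ₚ R) i - coeff (Q +ₚ T) i
        ≡⟨ cong₂ _-_ (coeff-+ P R i) (coeff-+ Q T i) ⟩
      (coeff P i + coeff R i) - (coeff Q i + coeff T i)
        ≡⟨ interchange (coeff P i) (coeff R i) (coeff Q i) (coeff T i) ⟩
      (coeff P i - coeff Q i) + (coeff R i - coeff T i)
        ≡⟨ cong₂ _+_ (difference-at c i) (difference-at d i) ⟩
      coeff (M *ₚ H) i + coeff (M *ₚ K) i
        ≡⟨ multiples-add H K i ⟩
      coeff (M *ₚ (H +ₚ K)) i ∎
      where
      open ≡-Reasoning
      interchange : ∀ p r q t → (p + r) - (q + t) ≡ (p - q) + (r - t)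
      interchange = solve-∀

    infixr 2 _≡ₘ⟨_⟩_ _≃⟨_⟩_
    infix  3 _∎

    _≡ₘ⟨_⟩_ : ∀ P {Q R} → P ≡ₘ Q → Q ≡ₘ R → P ≡ₘ R
    P ≡ₘ⟨ p ⟩ q = ≡ₘ-trans p q

    _≃⟨_⟩_ : ∀ P {Q R} → P ≃ Q → Q ≡ₘ R → P ≡ₘ R
    P ≃⟨ p ⟩ q = ≡ₘ-trans (≃⇒≡ₘ p) q

    _∎ : ∀ P → P ≡ₘ P
    P ∎ = ≃⇒≡ₘ ≃-refl

    sum-≡ₘ : ∀ {A : Set} {f g : A → Poly} xs → (∀ {x} → x ∈ xs → f x ≡ₘ g x) → sumₚ (map f xs) ≡ₘ sumₚ (map g xs)
    sum-≡ₘ []       f≡g = ≃⇒≡ₘ ≃-refl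
    sum-≡ₘ (x ∷ xs) f≡g = ≡ₘ-+ (f≡g (here refl)) (sum-≡ₘ xs (f≡g ∘ there))

  module Periodicity (n : ℕ) where
    open Congruence (qpow n -ₚ oneₚ)

    M : Poly
    M = qpow n -ₚ oneₚ

    -- q^(a+n) - q^a = M q^a, by induction on a (for a = 0 the difference is M itself)
    qpow-+n : ∀ a → qpow (a ℕ.+ n) ≡ₘ qpow a
    qpow-+n zero    = oneₚ by ≃-sym (*-identityʳ M)
    qpow-+n (suc a) with qpow-+n a
    ... | H by d = (+0 ∷ H) by ≃-trans (shift-cong d) (≃-sym (*-shiftʳ M H))

    qpow-periodic : ∀ a k → qpow (a ℕ.+ k ℕ.* n) ≡ₘ qpow a
    qpow-periodic a zero    = ≃⇒≡ₘ (≡⇒≃ (cong qpow (ℕP.+-identityʳ a)))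
    qpow-periodic a (suc k) =
      qpow (a ℕ.+ (n ℕ.+ k ℕ.* n))   ≃⟨ ≡⇒≃ (cong qpow (regroup a n (k ℕ.* n))) ⟩
      qpow (a ℕ.+ k ℕ.* n ℕ.+ n)     ≡ₘ⟨ qpow-+n (a ℕ.+ k ℕ.* n) ⟩
      qpow (a ℕ.+ k ℕ.* n)           ≡ₘ⟨ qpow-periodic a k ⟩
      qpow a                         ∎
      where
      regroup : ∀ a n m → a ℕ.+ (n ℕ.+ m) ≡ (a ℕ.+ m) ℕ.+ n
      regroup a n m = trans (cong (a ℕ.+_) (ℕP.+-comm n m)) (sym (ℕP.+-assoc a m n))

module ExponentMultisets where

  open Polynomials
  open import Data.Nat using (ℕ; zero; suc; _+_)
  open import Data.List using (List; []; _∷_; _++_; map; concatMap; applyUpTo)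
  import Data.List.Properties as LP
  import Data.List.Relation.Binary.Permutation.Propositional as Perm
  open Perm using (_↭_; prep; swap; ↭-refl; ↭-trans)
  import Data.List.Relation.Binary.Permutation.Propositional.Properties as PermP
  open import Algebra.Bundles using (CommutativeMonoid)
  open import Algebra.Properties.CommutativeSemigroup
    (CommutativeMonoid.commutativeSemigroup (PermP.++-commutativeMonoid {A = ℕ})) using (interchange)
  open import Relation.Binary.PropositionalEquality using (_≡_; refl; cong; cong₂; sym; trans)
  open import Function using (_∘_)

  sum-++ : ∀ Ps Qs → sumₚ (Ps ++ Qs) ≃ sumₚ Ps +ₚ sumₚ Qs
  sum-++ []       Qs = ≃-refl
  sum-++ (P ∷ Ps) Qs = ≃-trans (+-cong (≃-refl {P}) (sum-++ Ps Qs)) (≃-sym (+-assoc P (sumₚ Ps) (sumₚ Qs)))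

  sum-↭ : ∀ {Ps Qs} → Ps ↭ Qs → sumₚ Ps ≃ sumₚ Qs
  sum-↭ Perm.refl   = ≃-refl
  sum-↭ (prep P p)  = +-cong (≃-refl {P}) (sum-↭ p)
  sum-↭ (swap {xs} {ys} P Q p) = ≃-trans (+-cong (≃-refl {P}) (+-cong (≃-refl {Q}) (sum-↭ p))) (exchange (sumₚ ys))
    where
    exchange : ∀ R → P +ₚ (Q +ₚ R) ≃ Q +ₚ (P +ₚ R)
    exchange R = ≃-trans (≃-sym (+-assoc P Q R)) (≃-trans (+-cong (+-comm P Q) (≃-refl {R})) (+-assoc Q P R))
  sum-↭ (Perm.trans p q) = ≃-trans (sum-↭ p) (sum-↭ q)

  sum-cong : ∀ {A : Set} {f g : A → Poly} xs → (∀ x → f x ≃ g x) → sumₚ (map f xs) ≃ sumₚ (map g xs)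
  sum-cong []       f≃g = ≃-refl
  sum-cong (x ∷ xs) f≃g = +-cong (f≃g x) (sum-cong xs f≃g)

  qsum : List ℕ → Poly
  qsum L = sumₚ (map qpow L)

  qsum-++ : ∀ L L′ → qsum (L ++ L′) ≃ qsum L +ₚ qsum L′
  qsum-++ L L′ = ≃-trans (≡⇒≃ (cong sumₚ (LP.map-++ qpow L L′))) (sum-++ (map qpow L) (map qpow L′))

  qsum-↭ : ∀ {L L′} → L ↭ L′ → qsum L ≃ qsum L′
  qsum-↭ p = sum-↭ (PermP.map⁺ qpow p)

  qpow-*-qsum : ∀ a L → qpow a *ₚ qsum L ≃ qsum (map (a +_) L)
  qpow-*-qsum a []      = *-zeroʳ (qpow a)
  qpow-*-qsum a (e ∷ L) = ≃-trans (*-distribˡ (qpow a) (qpow e) (qsum L)) (+-cong (qpow-+ a e) (qpow-*-qsum a L))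

  sum-of-qsums : ∀ {A : Set} (F : A → List ℕ) xs → sumₚ (map (qsum ∘ F) xs) ≃ qsum (concatMap F xs)
  sum-of-qsums F []       = ≃-refl
  sum-of-qsums F (x ∷ xs) = ≃-trans (+-cong (≃-refl {qsum (F x)}) (sum-of-qsums F xs)) (≃-sym (qsum-++ (F x) (concatMap F xs)))

  concatUpTo : (ℕ → List ℕ) → ℕ → List ℕ
  concatUpTo F zero    = []
  concatUpTo F (suc n) = F 0 ++ concatUpTo (F ∘ suc) n

  concatMap-applyUpTo : ∀ (F : ℕ → List ℕ) g n → concatMap F (applyUpTo g n) ≡ concatUpTo (F ∘ g) n
  concatMap-applyUpTo F g zero    = refl
  concatMap-applyUpTo F g (suc n) = cong (F (g 0) ++_) (concatMap-applyUpTo F (g ∘ suc) n)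

  concatUpTo-snoc : ∀ F n → concatUpTo F (suc n) ≡ concatUpTo F n ++ F n
  concatUpTo-snoc F zero    = LP.++-identityʳ (F 0)
  concatUpTo-snoc F (suc n) =
    trans (cong (F 0 ++_) (concatUpTo-snoc (F ∘ suc) n)) (sym (LP.++-assoc (F 0) (concatUpTo (F ∘ suc) n) (F (suc n))))

  concatUpTo-cong : ∀ {F G} n → (∀ k → F k ≡ G k) → concatUpTo F n ≡ concatUpTo G n
  concatUpTo-cong zero    F≡G = refl
  concatUpTo-cong (suc n) F≡G = cong₂ _++_ (F≡G 0) (concatUpTo-cong n (F≡G ∘ suc))

  concatUpTo-map : ∀ f F n → map f (concatUpTo F n) ≡ concatUpTo (map f ∘ F) n
  concatUpTo-map f F zero    = refl
  concatUpTo-map f F (suc n) = trans (LP.map-++ f (F 0) _) (cong (map f (F 0) ++_) (concatUpTo-map f (F ∘ suc) n))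

  concatUpTo-++ : ∀ F G n → concatUpTo (λ k → F k ++ G k) n ↭ concatUpTo F n ++ concatUpTo G n
  concatUpTo-++ F G zero    = ↭-refl
  concatUpTo-++ F G (suc n) =
    ↭-trans (PermP.++⁺ˡ (F 0 ++ G 0) (concatUpTo-++ (F ∘ suc) (G ∘ suc) n))
            (interchange (F 0) (G 0) (concatUpTo (F ∘ suc) n) (concatUpTo (G ∘ suc) n))

module QBinomialTheorem where

  open Polynomials
  open ExponentMultisets
  open import Data.Nat using (ℕ; zero; suc; _+_; _*_)
  import Data.Nat.Properties as ℕP
  open import Data.Nat.Combinatorics using (_C_; nCk+nC[k+1]≡[n+1]C[k+1]; nC1≡n)
  open import Data.Nat.Tactic.RingSolver using (solve-∀)
  open import Data.List using (List; []; _∷_; _++_; map; concatMap; upTo)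
  import Data.List.Properties as LP
  open import Data.List.Relation.Binary.Permutation.Propositional using (_↭_; ↭-reflexive; module PermutationReasoning)
  import Data.List.Relation.Binary.Permutation.Propositional.Properties as PermP
  open import Algebra.Bundles using (CommutativeMonoid)
  open import Algebra.Properties.CommutativeSemigroup
    (CommutativeMonoid.commutativeSemigroup (PermP.++-commutativeMonoid {A = ℕ})) using (interchange)
  open import Relation.Binary.PropositionalEquality
  open import Function using (_∘_; id)
  import Relation.Binary.Reasoning.Setoid as SetoidReasoning

  -- Exponent multiset of the Gaussian binomial, read off the q-Pascal
  -- recurrence [n+1, k+1] = [n, k] + q^(k+1) [n, k+1].
  gaussExponents : ℕ → ℕ → List ℕ
  gaussExponents n       zero    = 0 ∷ []
  gaussExponents zero    (suc k) = []
  gaussExponents (suc n) (suc k) = gaussExponents n k ++ map (suc k +_) (gaussExponents n (suc k))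

  gauss≃qsum : ∀ n k → gauss n k ≃ qsum (gaussExponents n k)
  gauss≃qsum n       zero    = ≃-refl
  gauss≃qsum zero    (suc k) = ≃-refl
  gauss≃qsum (suc n) (suc k) =
    ≃-trans (+-cong (gauss≃qsum n k)
                    (≃-trans (*-congʳ (qpow (suc k)) (gauss≃qsum n (suc k))) (qpow-*-qsum (suc k) (gaussExponents n (suc k)))))
            (≃-sym (qsum-++ (gaussExponents n k) (map (suc k +_) (gaussExponents n (suc k)))))

  gaussExponents-vanish : ∀ n j → gaussExponents n (suc (n + j)) ≡ []
  gaussExponents-vanish zero    j = refl
  gaussExponents-vanish (suc n) j =
    cong₂ _++_ (gaussExponents-vanish n j)
               (cong (map (suc (suc (n + j)) +_))
                     (trans (cong (gaussExponents n ∘ suc) (sym (ℕP.+-suc n j))) (gaussExponents-vanish n (suc j))))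

  -- Exponent multiset of ∏_{i<n} (1 + q^(a+i)): all subset sums of {a, …, a+n-1}.
  subsetSums : ℕ → ℕ → List ℕ
  subsetSums a zero    = 0 ∷ []
  subsetSums a (suc n) = subsetSums (suc a) n ++ map (a +_) (subsetSums (suc a) n)

  -- The exponent a k + C(k,2) carried by the k-th term of the q-binomial theorem.
  binomialShift : ℕ → ℕ → ℕ
  binomialShift a k = a * k + k C 2

  binomialShift-zero : ∀ a → binomialShift a 0 + 0 ≡ 0
  binomialShift-zero a rewrite ℕP.*-zeroʳ a = refl

  private
    suc-C2 : ∀ k → suc k C 2 ≡ k + k C 2
    suc-C2 k = trans (sym (nCk+nC[k+1]≡[n+1]C[k+1] k 1)) (cong (_+ k C 2) (nC1≡n k))

  -- the two branches of the q-Pascal recurrence, moved from offset a to a+1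
  binomialShift-left : ∀ a k x → binomialShift a (suc k) + x ≡ a + (binomialShift (suc a) k + x)
  binomialShift-left a k x rewrite suc-C2 k = regroup a k x (k C 2)
    where
    regroup : ∀ a k x c → a * suc k + (k + c) + x ≡ a + (suc a * k + c + x)
    regroup = solve-∀

  binomialShift-right : ∀ a k x → binomialShift a (suc k) + (suc k + x) ≡ binomialShift (suc a) (suc k) + x
  binomialShift-right a k x rewrite suc-C2 k = regroup a k x (k C 2)
    where
    regroup : ∀ a k x c → a * suc k + (k + c) + (suc k + x) ≡ suc a * suc k + (k + c) + x
    regroup = solve-∀

  binomialSide : ℕ → ℕ → List ℕ
  binomialSide n a = concatUpTo (λ k → map (binomialShift a k +_) (gaussExponents n k)) (suc n)

  q-binomial : ∀ n a → binomialSide n a ↭ subsetSums a n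
  q-binomial zero    a = ↭-reflexive (cong (_∷ []) (binomialShift-zero a))
  q-binomial (suc n) a = begin
    binomialSide (suc n) a
      ≡⟨ cong (e₀ ∷_) (concatUpTo-cong (suc n) pascal) ⟩
    e₀ ∷ concatUpTo (λ k → map (a +_) (T k) ++ T (suc k)) (suc n)
      ↭⟨ PermP.++⁺ˡ (e₀ ∷ []) (concatUpTo-++ (map (a +_) ∘ T) (T ∘ suc) (suc n)) ⟩
    e₀ ∷ (concatUpTo (map (a +_) ∘ T) (suc n) ++ concatUpTo (T ∘ suc) (suc n))
      ↭⟨ PermP.shifts (e₀ ∷ []) (concatUpTo (map (a +_) ∘ T) (suc n)) ⟩
    concatUpTo (map (a +_) ∘ T) (suc n) ++ (e₀ ∷ concatUpTo (T ∘ suc) (suc n))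
      ≡⟨ cong (_++ (e₀ ∷ concatUpTo (T ∘ suc) (suc n))) (sym (concatUpTo-map (a +_) T (suc n))) ⟩
    map (a +_) B ++ (e₀ ∷ concatUpTo (T ∘ suc) (suc n))
      ↭⟨ PermP.++⁺ˡ (map (a +_) B) unshift ⟩
    map (a +_) B ++ B
      ↭⟨ PermP.++-comm (map (a +_) B) B ⟩
    B ++ map (a +_) B
      ↭⟨ PermP.++⁺ (q-binomial n (suc a)) (PermP.map⁺ (a +_) (q-binomial n (suc a))) ⟩
    subsetSums a (suc n) ∎
    where
    open PermutationReasoning
    T : ℕ → List ℕ
    T k = map (binomialShift (suc a) k +_) (gaussExponents n k)
    B : List ℕ
    B = binomialSide n (suc a)
    e₀ : ℕ
    e₀ = binomialShift a 0 + 0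

    pascal : ∀ k → map (binomialShift a (suc k) +_) (gaussExponents (suc n) (suc k)) ≡ map (a +_) (T k) ++ T (suc k)
    pascal k = trans (LP.map-++ _ (gaussExponents n k) _)
      (cong₂ _++_ (trans (LP.map-cong (binomialShift-left a k) (gaussExponents n k)) (LP.map-∘ (gaussExponents n k)))
                  (trans (sym (LP.map-∘ (gaussExponents n (suc k)))) (LP.map-cong (binomialShift-right a k) (gaussExponents n (suc k)))))

    -- the k = 0 term at offset a is the k = 0 term at offset a+1, and the k = n+1 term vanishes
    unshift : e₀ ∷ concatUpTo (T ∘ suc) (suc n) ↭ B
    unshift = begin
      e₀ ∷ concatUpTo (T ∘ suc) (suc n)
        ≡⟨ cong (_∷ concatUpTo (T ∘ suc) (suc n)) (trans (binomialShift-zero a) (sym (binomialShift-zero (suc a)))) ⟩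
      concatUpTo T (suc (suc n))
        ≡⟨ concatUpTo-snoc T (suc n) ⟩
      B ++ T (suc n)
        ≡⟨ cong (λ L → B ++ map (binomialShift (suc a) (suc n) +_) L)
                (trans (cong (gaussExponents n ∘ suc) (sym (ℕP.+-identityʳ n))) (gaussExponents-vanish n 0)) ⟩
      B ++ []
        ≡⟨ LP.++-identityʳ B ⟩
      B ∎

  q-binomial-poly : ∀ n → sumₚ (map (λ k → qpow (k C 2) *ₚ gauss n k) (upTo (suc n))) ≃ qsum (subsetSums 0 n)
  q-binomial-poly n = begin
    sumₚ (map (λ k → qpow (k C 2) *ₚ gauss n k) (upTo (suc n)))
      ≈⟨ sum-cong (upTo (suc n)) term ⟩
    sumₚ (map (qsum ∘ F) (upTo (suc n)))
      ≈⟨ sum-of-qsums F (upTo (suc n)) ⟩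
    qsum (concatMap F (upTo (suc n)))
      ≡⟨ cong qsum (concatMap-applyUpTo F id (suc n)) ⟩
    qsum (binomialSide n 0)
      ≈⟨ qsum-↭ (q-binomial n 0) ⟩
    qsum (subsetSums 0 n) ∎
    where
    open SetoidReasoning ≃-setoid
    F : ℕ → List ℕ
    F k = map (k C 2 +_) (gaussExponents n k)
    term : ∀ k → qpow (k C 2) *ₚ gauss n k ≃ qsum (F k)
    term k = ≃-trans (*-congʳ (qpow (k C 2)) (gauss≃qsum n k)) (qpow-*-qsum (k C 2) (gaussExponents n k))

module WordStatistics where

  open QBinomialTheorem using (subsetSums)
  open import Data.Bool using (Bool; true; false; not; _∧_; _xor_; if_then_else_)
  open import Data.Nat using (ℕ; zero; suc; _+_; _*_)
  import Data.Nat.Properties as ℕP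
  open import Data.Nat.Tactic.RingSolver using (solve-∀)
  open import Data.List using (List; []; _∷_; _++_; _∷ʳ_; map; length)
  import Data.List.Properties as LP
  open import Data.List.Relation.Binary.Permutation.Propositional using (_↭_; ↭-refl; swap; refl; module PermutationReasoning)
  import Data.List.Relation.Binary.Permutation.Propositional.Properties as PermP
  open import Algebra.Bundles using (CommutativeMonoid)
  open import Algebra.Properties.CommutativeSemigroup
    (CommutativeMonoid.commutativeSemigroup (PermP.++-commutativeMonoid {A = ℕ})) using (interchange)
  open import Data.Product using (Σ; _,_)
  open import Relation.Binary.PropositionalEquality
  open import Function using (_∘_)

  allWords : ℕ → List (List Bool)
  allWords zero    = [] ∷ []
  allWords (suc k) = map (false ∷_) (allWords k) ++ map (true ∷_) (allWords k)

  -- Statistics of a word p b₁ b₂ … whose first letter p sits at position i: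
  -- the sum of the positions j with letter j ≠ letter j+1, the sum of the
  -- descent positions (letter j = 1, letter j+1 = 0), and the number of descents.
  changeSum : ℕ → Bool → List Bool → ℕ
  changeSum i p []      = 0
  changeSum i p (b ∷ w) = (if p xor b then i else 0) + changeSum (suc i) b w

  descentSum : ℕ → Bool → List Bool → ℕ
  descentSum i p []      = 0
  descentSum i p (b ∷ w) = (if p ∧ not b then i else 0) + descentSum (suc i) b w

  descentCount : Bool → List Bool → ℕ
  descentCount p []      = 0
  descentCount p (b ∷ w) = (if p ∧ not b then 1 else 0) + descentCount b w

  lastLetter : Bool → List Bool → Bool
  lastLetter p []      = p
  lastLetter p (b ∷ w) = lastLetter b w

  majFrom≡descentSum : ∀ i p w → majFrom i (p ∷ w) ≡ descentSum i p w
  majFrom≡descentSum i true  []          = refl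
  majFrom≡descentSum i false []          = refl
  majFrom≡descentSum i true  (true  ∷ w) = majFrom≡descentSum (suc i) true w
  majFrom≡descentSum i true  (false ∷ w) = cong (i +_) (majFrom≡descentSum (suc i) false w)
  majFrom≡descentSum i false (b ∷ w)     = majFrom≡descentSum (suc i) b w

  descentSum-++ : ∀ i p xs ys →
    descentSum i p (xs ++ ys) ≡ descentSum i p xs + descentSum (i + length xs) (lastLetter p xs) ys
  descentSum-++ i p []       ys = cong (λ j → descentSum j p ys) (sym (ℕP.+-identityʳ i))
  descentSum-++ i p (x ∷ xs) ys = begin
    d + descentSum (suc i) x (xs ++ ys)
      ≡⟨ cong (d +_) (descentSum-++ (suc i) x xs ys) ⟩
    d + (descentSum (suc i) x xs + descentSum (suc i + length xs) (lastLetter x xs) ys)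
      ≡⟨ ℕP.+-assoc d _ _ ⟨
    d + descentSum (suc i) x xs + descentSum (suc i + length xs) (lastLetter x xs) ys
      ≡⟨ cong (λ j → d + descentSum (suc i) x xs + descentSum j (lastLetter x xs) ys) (sym (ℕP.+-suc i (length xs))) ⟩
    d + descentSum (suc i) x xs + descentSum (i + suc (length xs)) (lastLetter x xs) ys ∎
    where
    open ≡-Reasoning
    d = if p ∧ not x then i else 0

  descentSum-shift : ∀ k i p w → descentSum (k + i) p w ≡ descentSum i p w + k * descentCount p w
  descentSum-shift k i p []      = sym (ℕP.*-zeroʳ k)
  descentSum-shift k i p (b ∷ w) = begin
    (if c then k + i else 0) + descentSum (suc (k + i)) b w
      ≡⟨ cong₂ _+_ (weight-shift c) (trans (cong (λ j → descentSum j b w) (sym (ℕP.+-suc k i))) (descentSum-shift k (suc i) b w)) ⟩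
    ((if c then i else 0) + k * (if c then 1 else 0)) + (descentSum (suc i) b w + k * descentCount b w)
      ≡⟨ regroup (if c then i else 0) k (if c then 1 else 0) (descentSum (suc i) b w) (descentCount b w) ⟩
    ((if c then i else 0) + descentSum (suc i) b w) + k * ((if c then 1 else 0) + descentCount b w) ∎
    where
    open ≡-Reasoning
    c = p ∧ not b
    weight-shift : ∀ c → (if c then k + i else 0) ≡ (if c then i else 0) + k * (if c then 1 else 0)
    weight-shift true  = trans (ℕP.+-comm k i) (cong (i +_) (sym (ℕP.*-identityʳ k)))
    weight-shift false = sym (ℕP.*-zeroʳ k)
    regroup : ∀ x k y z w → (x + k * y) + (z + k * w) ≡ (x + z) + k * (y + w)
    regroup = solve-∀

  -- ... and the descents of the complement are the ascents, so together
  -- with the descents they are all the changes.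
  descentSum-complement : ∀ i p w → descentSum i (not p) (map not w) + descentSum i p w ≡ changeSum i p w
  descentSum-complement i p     []          = refl
  descentSum-complement i false (false ∷ w) = descentSum-complement (suc i) false w
  descentSum-complement i true  (true  ∷ w) = descentSum-complement (suc i) true w
  descentSum-complement i false (true  ∷ w) =
    trans (ℕP.+-assoc i _ _) (cong (i +_) (descentSum-complement (suc i) true w))
  descentSum-complement i true  (false ∷ w) =
    trans (ℕP.+-comm (descentSum (suc i) true (map not w)) (i + _))
          (trans (ℕP.+-assoc i _ _)
                 (cong (i +_) (trans (ℕP.+-comm _ (descentSum (suc i) true (map not w)))
                                     (descentSum-complement (suc i) false w))))

  lastLetter-complement : ∀ p w → lastLetter (not p) (map not w) ≡ not (lastLetter p w)
  lastLetter-complement p []      = refl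
  lastLetter-complement p (b ∷ w) = lastLetter-complement b w

  lastLetter-∷ʳ : ∀ p w (x : Bool) → lastLetter p (w ∷ʳ x) ≡ x
  lastLetter-∷ʳ p []      x = refl
  lastLetter-∷ʳ p (b ∷ w) x = lastLetter-∷ʳ b w x

  mirror : List Bool → List Bool
  mirror v = map not v ++ v

  maj-mirror : ∀ p w → lastLetter p w ≡ true →
    maj (mirror (p ∷ w)) ≡ changeSum 1 p w + descentCount p w * length (p ∷ w)
  maj-mirror p w ends-in-1 = begin
    majFrom 1 (not p ∷ (map not w ++ p ∷ w))
      ≡⟨ majFrom≡descentSum 1 (not p) (map not w ++ p ∷ w) ⟩
    descentSum 1 (not p) (map not w ++ p ∷ w)
      ≡⟨ descentSum-++ 1 (not p) (map not w) (p ∷ w) ⟩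
    descentSum 1 (not p) (map not w) + descentSum (suc (length (map not w))) (lastLetter (not p) (map not w)) (p ∷ w)
      ≡⟨ cong₂ (λ ℓ b → descentSum 1 (not p) (map not w) + descentSum (suc ℓ) b (p ∷ w))
               (LP.length-map not w) (trans (lastLetter-complement p w) (cong not ends-in-1)) ⟩
    descentSum 1 (not p) (map not w) + descentSum (1 + N) p w
      ≡⟨ cong (λ j → descentSum 1 (not p) (map not w) + descentSum j p w) (ℕP.+-comm 1 N) ⟩
    descentSum 1 (not p) (map not w) + descentSum (N + 1) p w
      ≡⟨ cong (descentSum 1 (not p) (map not w) +_) (descentSum-shift N 1 p w) ⟩
    descentSum 1 (not p) (map not w) + (descentSum 1 p w + N * descentCount p w)
      ≡⟨ ℕP.+-assoc (descentSum 1 (not p) (map not w)) _ _ ⟨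
    (descentSum 1 (not p) (map not w) + descentSum 1 p w) + N * descentCount p w
      ≡⟨ cong₂ _+_ (descentSum-complement 1 p w) (ℕP.*-comm N (descentCount p w)) ⟩
    changeSum 1 p w + descentCount p w * N ∎
    where
    open ≡-Reasoning
    N = length (p ∷ w)

  length-∷ʳ : ∀ (u : List Bool) x → length (u ∷ʳ x) ≡ suc (length u)
  length-∷ʳ u x = trans (LP.length-++ u) (ℕP.+-comm (length u) 1)

  changeStat : List Bool → ℕ
  changeStat []      = 0
  changeStat (p ∷ w) = changeSum 1 p w

  maj-mirror-∷ʳ : ∀ u → Σ ℕ λ k → maj (mirror (u ∷ʳ true)) ≡ changeStat (u ∷ʳ true) + k * suc (length u)
  maj-mirror-∷ʳ []      = 0 , refl
  maj-mirror-∷ʳ (p ∷ u) =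
    descentCount p (u ∷ʳ true) ,
    trans (maj-mirror p (u ∷ʳ true) (lastLetter-∷ʳ p u true))
          (cong (λ ℓ → changeSum 1 p (u ∷ʳ true) + descentCount p (u ∷ʳ true) * suc ℓ) (length-∷ʳ u true))

  changeSums : ℕ → Bool → ℕ → Bool → List ℕ
  changeSums a x k t = map (λ u → changeSum a x (u ∷ʳ t)) (allWords k)

  changeSums-suc : ∀ a x k t →
    changeSums a x (suc k) t ≡ map ((if x xor false then a else 0) +_) (changeSums (suc a) false k t)
                            ++ map ((if x xor true then a else 0) +_) (changeSums (suc a) true k t)
  changeSums-suc a x k t =
    trans (LP.map-++ _ (map (false ∷_) (allWords k)) _)
          (cong₂ _++_ (trans (sym (LP.map-∘ (allWords k))) (LP.map-∘ (allWords k)))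
                      (trans (sym (LP.map-∘ (allWords k))) (LP.map-∘ (allWords k))))

  -- With the first letter free and the last letter t fixed, the change-position
  -- sums of words of length k+2 run exactly once through all subset sums of
  -- {a, …, a+k}: a change at position a happens for exactly one first letter.
  changeSums-distribution : ∀ a k t → changeSums a false k t ++ changeSums a true k t ↭ subsetSums a (suc k)
  changeSums-distribution a zero    false = ↭-refl
  changeSums-distribution a zero    true  = swap (a + 0) 0 refl
  changeSums-distribution a (suc k) t = begin
    changeSums a false (suc k) t ++ changeSums a true (suc k) t
      ≡⟨ cong₂ _++_ (trans (changeSums-suc a false k t) (cong (_++ map (a +_) B) (LP.map-id A)))
                    (trans (changeSums-suc a true k t) (cong (map (a +_) A ++_) (LP.map-id B))) ⟩
    (A ++ map (a +_) B) ++ (map (a +_) A ++ B)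
      ↭⟨ interchange A (map (a +_) B) (map (a +_) A) B ⟩
    (A ++ map (a +_) A) ++ (map (a +_) B ++ B)
      ↭⟨ PermP.++⁺ˡ (A ++ map (a +_) A) (PermP.++-comm (map (a +_) B) B) ⟩
    (A ++ map (a +_) A) ++ (B ++ map (a +_) B)
      ↭⟨ interchange A (map (a +_) A) B (map (a +_) B) ⟩
    (A ++ B) ++ (map (a +_) A ++ map (a +_) B)
      ≡⟨ cong ((A ++ B) ++_) (LP.map-++ (a +_) A B) ⟨
    (A ++ B) ++ map (a +_) (A ++ B)
      ↭⟨ PermP.++⁺ (changeSums-distribution (suc a) k t) (PermP.map⁺ (a +_) (changeSums-distribution (suc a) k t)) ⟩
    subsetSums a (suc (suc k)) ∎
    where
    open PermutationReasoning
    A = changeSums (suc a) false k t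
    B = changeSums (suc a) true k t

  changeStat-distribution : ∀ m → map changeStat (map (_∷ʳ true) (allWords m)) ↭ subsetSums 1 m
  changeStat-distribution zero    = ↭-refl
  changeStat-distribution (suc k) = begin
    map changeStat (map (_∷ʳ true) (allWords (suc k)))
      ≡⟨ LP.map-∘ (allWords (suc k)) ⟨
    map (changeStat ∘ (_∷ʳ true)) (allWords (suc k))
      ≡⟨ LP.map-++ (changeStat ∘ (_∷ʳ true)) (map (false ∷_) (allWords k)) _ ⟩
    map (changeStat ∘ (_∷ʳ true)) (map (false ∷_) (allWords k)) ++ map (changeStat ∘ (_∷ʳ true)) (map (true ∷_) (allWords k))
      ≡⟨ cong₂ _++_ (LP.map-∘ (allWords k)) (LP.map-∘ (allWords k)) ⟨
    changeSums 1 false k true ++ changeSums 1 true k true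
      ↭⟨ changeSums-distribution 1 k true ⟩
    subsetSums 1 (suc k) ∎
    where open PermutationReasoning

module LatticePaths where

  open WordStatistics using (mirror)
  open import Data.Bool using (Bool; true; false; not)
  open import Data.Nat using (ℕ; suc; _+_; _∸_; _⊔_; _≤_; _<_; s≤s; z≤n)
  open import Data.Nat.Properties
  open import Data.List using (List; []; _∷_; _++_; map)
  open import Data.Product using (Σ; _×_; _,_)
  open import Relation.Binary.PropositionalEquality

  -- The largest lead of east over north steps (resp. north over east
  -- steps) among the prefixes of a path, the empty prefix included.
  eastLead northLead : List Bool → ℕ
  eastLead []          = 0
  eastLead (false ∷ w) = suc (eastLead w)
  eastLead (true  ∷ w) = eastLead w ∸ 1
  northLead []          = 0
  northLead (false ∷ w) = northLead w ∸ 1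
  northLead (true  ∷ w) = suc (northLead w)

  eastLead≤numZeros : ∀ w → eastLead w ≤ numZeros w
  eastLead≤numZeros []          = z≤n
  eastLead≤numZeros (false ∷ w) = s≤s (eastLead≤numZeros w)
  eastLead≤numZeros (true  ∷ w) = ≤-trans (m∸n≤m (eastLead w) 1) (eastLead≤numZeros w)

  northLead≤numOnes : ∀ w → northLead w ≤ numOnes w
  northLead≤numOnes []          = z≤n
  northLead≤numOnes (false ∷ w) = ≤-trans (m∸n≤m (northLead w) 1) (northLead≤numOnes w)
  northLead≤numOnes (true  ∷ w) = s≤s (northLead≤numOnes w)

  eastLead-complement : ∀ w → eastLead (map not w) ≡ northLead w
  northLead-complement : ∀ w → northLead (map not w) ≡ eastLead w
  eastLead-complement []          = refl
  eastLead-complement (false ∷ w) = cong (_∸ 1) (eastLead-complement w)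
  eastLead-complement (true  ∷ w) = cong suc (eastLead-complement w)
  northLead-complement []          = refl
  northLead-complement (false ∷ w) = cong suc (northLead-complement w)
  northLead-complement (true  ∷ w) = cong (_∸ 1) (northLead-complement w)

  numZeros-complement : ∀ w → numZeros (map not w) ≡ numOnes w
  numOnes-complement : ∀ w → numOnes (map not w) ≡ numZeros w
  numZeros-complement []          = refl
  numZeros-complement (false ∷ w) = numZeros-complement w
  numZeros-complement (true  ∷ w) = cong suc (numZeros-complement w)
  numOnes-complement []          = refl
  numOnes-complement (false ∷ w) = cong suc (numOnes-complement w)
  numOnes-complement (true  ∷ w) = numOnes-complement w

  offLines : ∀ n x y → y < x → x ≤ y + suc n → OffLines n x y
  offLines n x y y<x x≤ = <⇒≢ y<x , λ eq → <⇒≢ (≤-<-trans x≤ below) (sym eq)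
    where
    below : y + suc n < y + (n + 2)
    below = +-monoʳ-< y (subst (suc n <_) (+-comm 2 n) (n<1+n (suc n)))

  window : ∀ n w x y → y + northLead w < x → x + eastLead w ≤ y + suc n → Avoids n x y w
  window n []          x y lo hi =
    offLines n x y (subst (_< x) (+-identityʳ y) lo) (subst (_≤ y + suc n) (+-identityʳ x) hi)
  window n (false ∷ w) x y lo hi =
    offLines n x y (≤-<-trans (m≤m+n y _) lo) (≤-trans (m≤m+n x _) hi) ,
    window n w (suc x) y
      (s≤s (≤-trans (+-monoʳ-≤ y (m≤n+m∸n (northLead w) 1)) (subst (_≤ x) (sym (+-suc y (northLead w ∸ 1))) lo)))
      (subst (_≤ y + suc n) (+-suc x (eastLead w)) hi)
  window n (true  ∷ w) x y lo hi =
    offLines n x y (≤-<-trans (m≤m+n y _) lo) (≤-trans (m≤m+n x _) hi) ,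
    window n w x (suc y)
      (subst (_≤ x) (cong suc (+-suc y (northLead w))) lo)
      (≤-trans (+-monoʳ-≤ x (m≤n+m∸n (eastLead w) 1)) (subst (_≤ suc y + suc n) (sym (+-suc x (eastLead w ∸ 1))) (s≤s hi)))

  Avoids-++ : ∀ n xs ys x y → Avoids n x y xs → Avoids n (x + numZeros xs) (y + numOnes xs) ys → Avoids n x y (xs ++ ys)
  Avoids-++ n []           ys x y _        rest =
    subst₂ (λ x′ y′ → Avoids n x′ y′ ys) (+-identityʳ x) (+-identityʳ y) rest
  Avoids-++ n (false ∷ xs) ys x y (o , ok) rest =
    o , Avoids-++ n xs ys (suc x) y ok (subst (λ x′ → Avoids n x′ (y + numOnes xs) ys) (+-suc x (numZeros xs)) rest)
  Avoids-++ n (true  ∷ xs) ys x y (o , ok) rest =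
    o , Avoids-++ n xs ys x (suc y) ok (subst (λ y′ → Avoids n (x + numZeros xs) y′ ys) (+-suc y (numOnes xs)) rest)

  -- With f zeros, t ones, east lead h and north lead l in v, the point
  -- x₀ = 1 + max(h, f + l - t) works.
  mirror-avoids : ∀ v → 1 ≤ numOnes v →
    Σ ℕ λ x₀ → (1 ≤ x₀) × (x₀ ≤ numZeros v + numOnes v) × Avoids (numZeros v + numOnes v) x₀ 0 (mirror v)
  mirror-avoids v 1≤t =
    suc M , s≤s z≤n , x₀≤n ,
    Avoids-++ n (map not v) v (suc M) 0
      (window n (map not v) (suc M) 0
        (subst (λ e → e < suc M) (sym (northLead-complement v)) (s≤s (m≤m⊔n h g)))
        (subst (λ e → suc M + e ≤ suc n) (sym (eastLead-complement v)) (s≤s (+-mono-≤ M≤f l≤t))))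
      (subst₂ (λ a b → Avoids n (suc M + a) b v) (sym (numZeros-complement v)) (sym (numOnes-complement v))
        (window n v (suc M + t) f
          (s≤s (≤-trans (f+l≤g+t) (+-monoˡ-≤ t (m≤n⊔m h g))))
          (subst (suc (M + t + h) ≤_) (sym (+-suc f n))
            (s≤s (≤-trans (+-mono-≤ (+-monoˡ-≤ t M≤f) h≤f) (≤-reflexive (+-comm (f + t) f)))))))
    where
    f = numZeros v
    t = numOnes v
    n = f + t
    h = eastLead v
    l = northLead v
    g = f + l ∸ t
    M = h ⊔ g
    h≤f : h ≤ f
    h≤f = eastLead≤numZeros v
    l≤t : l ≤ t
    l≤t = northLead≤numOnes v
    M≤f : M ≤ f
    M≤f = ⊔-lub h≤f (≤-trans (∸-monoˡ-≤ t (+-monoʳ-≤ f l≤t)) (≤-reflexive (m+n∸n≡m f t)))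
    f+l≤g+t : f + l ≤ g + t
    f+l≤g+t = subst (f + l ≤_) (+-comm t g) (m≤n+m∸n (f + l) t)
    x₀≤n : suc M ≤ n
    x₀≤n = ≤-trans (s≤s M≤f) (subst (_≤ n) (+-comm f 1) (+-monoʳ-≤ f 1≤t))

module CircularMobiusWords where

  open WordStatistics using (allWords; mirror; length-∷ʳ)
  open LatticePaths using (mirror-avoids; numZeros-complement; numOnes-complement)
  open import Data.Bool using (Bool; true; false; not)
  open import Data.Nat using (ℕ; zero; suc; _+_; _≤_; s≤s; z≤n)
  import Data.Nat.Properties as ℕP
  open import Data.List using (List; []; _∷_; _++_; _∷ʳ_; map; length; take; drop; last; initLast; _∷ʳ′_)
  import Data.List.Properties as LP
  open import Data.List.Membership.Propositional using (_∈_)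
  open import Data.List.Membership.Propositional.Properties using (∈-map⁺; ∈-map⁻; ∈-++⁺ˡ; ∈-++⁺ʳ; ∈-++⁻)
  open import Data.List.Relation.Unary.Any using (here)
  open import Data.List.Relation.Unary.Unique.Propositional using (Unique; []; _∷_)
  import Data.List.Relation.Unary.Unique.Propositional.Properties as Unique
  open import Data.List.Relation.Unary.All using ([]; _∷_)
  open import Data.List.Relation.Binary.Permutation.Propositional using (_↭_)
  open import Data.List.Membership.Propositional.Properties.WithK using (unique∧set⇒bag)
  open import Data.List.Relation.Binary.BagAndSetEquality using (∼bag⇒↭)
  open import Data.Maybe using (just)
  import Data.Maybe.Properties as MaybeP
  open import Data.Product using (_×_; _,_)
  open import Data.Sum using (inj₁; inj₂)
  open import Function.Bundles using (_⇔_; mk⇔; Equivalence)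
  open import Relation.Binary.PropositionalEquality
  open import Data.Empty using (⊥)

  allWords-complete : ∀ u → u ∈ allWords (length u)
  allWords-complete []          = here refl
  allWords-complete (false ∷ u) = ∈-++⁺ˡ (∈-map⁺ (false ∷_) (allWords-complete u))
  allWords-complete (true  ∷ u) = ∈-++⁺ʳ (map (false ∷_) (allWords (length u))) (∈-map⁺ (true ∷_) (allWords-complete u))

  allWords-length : ∀ m {u} → u ∈ allWords m → length u ≡ m
  allWords-length zero    (here refl) = refl
  allWords-length (suc m) u∈ with ∈-++⁻ (map (false ∷_) (allWords m)) u∈
  ... | inj₁ u∈₀ with ∈-map⁻ (false ∷_) u∈₀
  ...   | w , w∈ , refl = cong suc (allWords-length m w∈)
  allWords-length (suc m) u∈ | inj₂ u∈₁ with ∈-map⁻ (true ∷_) u∈₁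
  ...   | w , w∈ , refl = cong suc (allWords-length m w∈)

  allWords-unique : ∀ m → Unique (allWords m)
  allWords-unique zero    = [] ∷ []
  allWords-unique (suc m) =
    Unique.++⁺ (Unique.map⁺ LP.∷-injectiveʳ (allWords-unique m)) (Unique.map⁺ LP.∷-injectiveʳ (allWords-unique m)) disjoint
    where
    disjoint : ∀ {v} → v ∈ map (false ∷_) (allWords m) × v ∈ map (true ∷_) (allWords m) → ⊥
    disjoint (v∈₀ , v∈₁) with ∈-map⁻ (false ∷_) v∈₀ | ∈-map⁻ (true ∷_) v∈₁
    ... | _ , _ , refl | _ , _ , ()

  numZeros+numOnes : ∀ w → numZeros w + numOnes w ≡ length w
  numZeros+numOnes []          = refl
  numZeros+numOnes (false ∷ w) = cong suc (numZeros+numOnes w)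
  numZeros+numOnes (true  ∷ w) = trans (ℕP.+-suc (numZeros w) (numOnes w)) (cong suc (numZeros+numOnes w))

  numZeros-++ : ∀ xs ys → numZeros (xs ++ ys) ≡ numZeros xs + numZeros ys
  numZeros-++ []          ys = refl
  numZeros-++ (true  ∷ xs) ys = numZeros-++ xs ys
  numZeros-++ (false ∷ xs) ys = cong suc (numZeros-++ xs ys)

  numOnes-++ : ∀ xs ys → numOnes (xs ++ ys) ≡ numOnes xs + numOnes ys
  numOnes-++ []          ys = refl
  numOnes-++ (true  ∷ xs) ys = cong suc (numOnes-++ xs ys)
  numOnes-++ (false ∷ xs) ys = numOnes-++ xs ys

  numOnes-∷ʳ-true : ∀ u → 1 ≤ numOnes (u ∷ʳ true)
  numOnes-∷ʳ-true u = subst (1 ≤_) (sym (trans (numOnes-++ u (true ∷ [])) (ℕP.+-comm (numOnes u) 1))) (s≤s z≤n)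

  take-length-++ : ∀ {A : Set} (xs ys : List A) → take (length xs) (xs ++ ys) ≡ xs
  take-length-++ []       ys = refl
  take-length-++ (x ∷ xs) ys = cong (x ∷_) (take-length-++ xs ys)

  drop-length-++ : ∀ {A : Set} (xs ys : List A) → drop (length xs) (xs ++ ys) ≡ ys
  drop-length-++ []       ys = refl
  drop-length-++ (x ∷ xs) ys = drop-length-++ xs ys

  last-∷ʳ : ∀ {A : Set} (xs : List A) x → last (xs ∷ʳ x) ≡ just x
  last-∷ʳ []           x = refl
  last-∷ʳ (y ∷ [])     x = refl
  last-∷ʳ (y ∷ z ∷ zs) x = last-∷ʳ (z ∷ zs) x

  last-mirror : ∀ u x → last (mirror (u ∷ʳ x)) ≡ just x
  last-mirror u x = trans (cong last (sym (LP.++-assoc (map not (u ∷ʳ x)) u (x ∷ [])))) (last-∷ʳ (map not (u ∷ʳ x) ++ u) x)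

  length-mirror : ∀ v → length (mirror v) ≡ length v + length v
  length-mirror v = trans (LP.length-++ (map not v)) (cong (_+ length v) (LP.length-map not v))

  mirror-injective : ∀ {v v′} → mirror v ≡ mirror v′ → v ≡ v′
  mirror-injective {v} {v′} eq = begin
    v                                         ≡⟨ drop-length-++ (map not v) v ⟨
    drop (length (map not v)) (mirror v)      ≡⟨ cong₂ drop same-length eq ⟩
    drop (length (map not v′)) (mirror v′)    ≡⟨ drop-length-++ (map not v′) v′ ⟩
    v′                                        ∎
    where
    open ≡-Reasoning
    double : ∀ n → n + n ≡ 2 Data.Nat.* n
    double n = cong (n +_) (sym (ℕP.+-identityʳ n))
    same-length : length (map not v) ≡ length (map not v′)
    same-length =
      trans (LP.length-map not v)
     (trans (ℕP.*-cancelˡ-≡ (length v) (length v′) 2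
              (trans (sym (double (length v)))
             (trans (sym (length-mirror v)) (trans (cong length eq) (trans (length-mirror v′) (double (length v′)))))))
            (sym (LP.length-map not v′)))

  cmpWords : ℕ → List (List Bool)
  cmpWords m = map mirror (map (_∷ʳ true) (allWords m))

  cmpWords-unique : ∀ m → Unique (cmpWords m)
  cmpWords-unique m = Unique.map⁺ mirror-injective (Unique.map⁺ (LP.∷ʳ-injectiveˡ _ _) (allWords-unique m))

  mirror-isCMP : ∀ m u → length u ≡ m → IsCMP (suc m) (mirror (u ∷ʳ true))
  mirror-isCMP m u len with mirror-avoids (u ∷ʳ true) (numOnes-∷ʳ-true u)
  ... | x₀ , 1≤x₀ , x₀≤n , avoids =
    x₀ , 1≤x₀ , subst (x₀ ≤_) size x₀≤n ,
    trans (numZeros-++ (map not v) v) (trans (cong (_+ numZeros v) (numZeros-complement v)) (trans (ℕP.+-comm (numOnes v) _) size)) ,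
    trans (numOnes-++ (map not v) v) (trans (cong (_+ numOnes v) (numOnes-complement v)) size) ,
    last-mirror u true ,
    subst (λ k → take k (mirror v) ≡ map not (drop k (mirror v))) half
          (trans (take-length-++ (map not v) v) (cong (map not) (sym (drop-length-++ (map not v) v)))) ,
    subst (λ n → Avoids n x₀ 0 (mirror v)) size avoids
    where
    v = u ∷ʳ true
    size : numZeros v + numOnes v ≡ suc m
    size = trans (numZeros+numOnes v) (trans (length-∷ʳ u true) (cong suc len))
    half : length (map not v) ≡ suc m
    half = trans (LP.length-map not v) (trans (length-∷ʳ u true) (cong suc len))

  candidate-isCMP : ∀ m {b} → b ∈ cmpWords m → IsCMP (suc m) b
  candidate-isCMP m b∈ with ∈-map⁻ mirror b∈
  ... | v , v∈ , refl with ∈-map⁻ (_∷ʳ true) v∈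
  ...   | u , u∈ , refl = mirror-isCMP m u (allWords-length m u∈)

  -- Conversely, a circular Möbius path word is the mirror image of its
  -- second half, which ends in 1.
  isCMP-candidate : ∀ m b → IsCMP (suc m) b → b ∈ cmpWords m
  isCMP-candidate m b (_ , _ , _ , zeros , ones , ends , halves , _) =
    subst (_∈ cmpWords m) (sym b≡mirror) (mirror-candidate v len-v (subst (λ c → last c ≡ just true) b≡mirror ends))
    where
    n = suc m
    v = drop n b
    b≡mirror : b ≡ mirror v
    b≡mirror = trans (sym (LP.take++drop≡id n b)) (cong (_++ v) halves)
    len-v : length v ≡ n
    len-v = trans (LP.length-drop n b)
           (trans (cong (Data.Nat._∸ n) (trans (sym (numZeros+numOnes b)) (cong₂ _+_ zeros ones))) (ℕP.m+n∸n≡m n n))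
    mirror-candidate : ∀ v → length v ≡ n → last (mirror v) ≡ just true → mirror v ∈ cmpWords m
    mirror-candidate v len ends with initLast v
    mirror-candidate .[]       () ends | []
    mirror-candidate .(u ∷ʳ x) len ends | u ∷ʳ′ x
      with refl ← MaybeP.just-injective (trans (sym (last-mirror u x)) ends) =
      ∈-map⁺ mirror (∈-map⁺ (_∷ʳ true) (subst (λ k → u ∈ allWords k) len-u (allWords-complete u)))
      where
      len-u : length u ≡ m
      len-u = ℕP.suc-injective (trans (sym (length-∷ʳ u true)) len)

  cmp↭cmpWords : ∀ m cmp → Unique cmp → (∀ b → (b ∈ cmp) ⇔ IsCMP (suc m) b) → cmp ↭ cmpWords m
  cmp↭cmpWords m cmp unique spec = ∼bag⇒↭ (unique∧set⇒bag unique (cmpWords-unique m) (λ {b} →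
    mk⇔ (λ b∈ → isCMP-candidate m b (Equivalence.to (spec b) b∈))
        (λ b∈ → Equivalence.from (spec b) (candidate-isCMP m b∈))))

open import Data.Bool using (Bool)
open import Data.Nat using (ℕ; _≤_; _∸_; suc)
open import Data.Nat.Combinatorics using (_C_)
open import Data.Integer using (+_)
open import Data.List using (List; map; upTo)
open import Data.List.Relation.Unary.Unique.Propositional using (Unique)
open import Data.List.Membership.Propositional using (_∈_)
open import Function.Bundles using (_⇔_)

open Polynomials
open PolynomialCongruences
open ExponentMultisets
open QBinomialTheorem
open WordStatistics
open CircularMobiusWords
import Data.Nat as ℕ
open import Data.Bool using (true)
open import Data.List using (_∷ʳ_)
import Data.List.Properties as LP
open import Data.List.Relation.Binary.Permutation.Propositional using (_↭_)
import Data.List.Relation.Binary.Permutation.Propositional.Properties as PermP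
open import Data.Product using (_,_)
open import Function using (_∘_)
open import Relation.Binary.PropositionalEquality using (cong; sym; trans)

module MajGeneratingFunction (m : ℕ) where
  open Congruence (qpow (suc m) -ₚ oneₚ)
  open Periodicity (suc m)

  W : List (List Bool)
  W = allWords m

  maj-≡ₘ-changeStat : ∀ {u} → u ∈ W → qpow (maj (mirror (u ∷ʳ true))) ≡ₘ qpow (changeStat (u ∷ʳ true))
  maj-≡ₘ-changeStat {u} u∈ with maj-mirror-∷ʳ u
  ... | k , maj≡ =
    qpow (maj (mirror (u ∷ʳ true)))
      ≃⟨ ≡⇒≃ (cong qpow (trans maj≡ (cong (λ ℓ → c ℕ.+ k ℕ.* suc ℓ) (allWords-length m u∈)))) ⟩
    qpow (c ℕ.+ k ℕ.* suc m)
      ≡ₘ⟨ qpow-periodic c k ⟩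
    qpow c ∎
    where
    c : ℕ
    c = changeStat (u ∷ʳ true)

  maj-sum : ∀ cmp → cmp ↭ cmpWords m → sumₚ (map (qpow ∘ maj) cmp) ≡ₘ qsum (subsetSums 1 m)
  maj-sum cmp cmp↭ =
    sumₚ (map (qpow ∘ maj) cmp)
      ≃⟨ sum-↭ (PermP.map⁺ (qpow ∘ maj) cmp↭) ⟩
    sumₚ (map (qpow ∘ maj) (map mirror (map (_∷ʳ true) W)))
      ≃⟨ ≡⇒≃ (cong sumₚ (trans (sym (LP.map-∘ (map (_∷ʳ true) W))) (sym (LP.map-∘ W)))) ⟩
    sumₚ (map (qpow ∘ maj ∘ mirror ∘ (_∷ʳ true)) W)
      ≡ₘ⟨ sum-≡ₘ W maj-≡ₘ-changeStat ⟩
    sumₚ (map (qpow ∘ changeStat ∘ (_∷ʳ true)) W)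
      ≃⟨ ≡⇒≃ (cong sumₚ (trans (LP.map-∘ W) (LP.map-∘ (map (_∷ʳ true) W)))) ⟩
    qsum (map changeStat (map (_∷ʳ true) W))
      ≃⟨ qsum-↭ (changeStat-distribution m) ⟩
    qsum (subsetSums 1 m) ∎

-- The factor 1 + q^0 = 2:  ∏_{i=0}^{m} (1 + q^i) = 2 ∏_{i=1}^{m} (1 + q^i).
subsetSums-from-0 : ∀ m → qsum (subsetSums 0 (suc m)) ≃ qsum (subsetSums 1 m) +ₚ qsum (subsetSums 1 m)
subsetSums-from-0 m = ≃-trans (qsum-++ (subsetSums 1 m) (map (0 ℕ.+_) (subsetSums 1 m)))
                              (≡⇒≃ (cong (λ L → qsum (subsetSums 1 m) +ₚ qsum L) (LP.map-id (subsetSums 1 m))))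

lemma6p5 : (n : ℕ) → 1 ≤ n → (cmp : List (List Bool)) → Unique cmp
    → (∀ b → (b ∈ cmp) ⇔ IsCMP n b)
    → ((+ 2) ·ₚ sumₚ (map (λ b → qpow (maj b)) cmp))
      ≡ sumₚ (map (λ k → qpow (k C 2) *ₚ gauss n k) (upTo (suc n)))
      mod (qpow n -ₚ oneₚ)
lemma6p5 0       () cmp unique spec
lemma6p5 (suc m) _  cmp unique spec = toMod (
  (+ 2) ·ₚ majSum                                           ≃⟨ two-· majSum ⟩
  majSum +ₚ majSum                                          ≡ₘ⟨ ≡ₘ-+ majSum≡ majSum≡ ⟩
  qsum (subsetSums 1 m) +ₚ qsum (subsetSums 1 m)            ≃⟨ ≃-sym (subsetSums-from-0 m) ⟩
  qsum (subsetSums 0 (suc m))                               ≃⟨ ≃-sym (q-binomial-poly (suc m)) ⟩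
  sumₚ (map (λ k → qpow (k C 2) *ₚ gauss (suc m) k) (upTo (suc (suc m)))) ∎)
  where
  open Congruence (qpow (suc m) -ₚ oneₚ)
  majSum : Poly
  majSum = sumₚ (map (λ b → qpow (maj b)) cmp)
  majSum≡ : majSum ≡ₘ qsum (subsetSums 1 m)
  majSum≡ = MajGeneratingFunction.maj-sum m cmp (cmp↭cmpWords m cmp unique spec)
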